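{- Let $H$ be the final configuration of a construction in the $(2,3)$-pebble game with colors, on vertex set $V$ with $|V|=n$. Let $G^*$ be obtained from the underlying undirected graph of $H$ by adding, for each pebble lying on a vertex $v$, one loop at $v$. Then $G^*$ is $(2,0,3)$-graded-tight. That is: (1) every subgraph of $G^*$ containing no loops, with $n'$ vertices and $m'\ge1$ edges, satisfies $m'\le 2n'-3$; (2) every subgraph of $G^*$ (loops allowed) with $n'$ vertices and $m'$ edges satisfies $m'\le 2n'$; (3) $G^*$ has exactly $2n$ edges.
   Context: The $(k,\ell)$-pebble game with colors (here $k=2$, $\ell=3$) is played on a fixed finite vertex set $V$. Its state is a directed multigraph $H$ on $V$ (loops allowed) together with pebbles, each having one of $k$ colors. Each pebble lies on a vertex or on an edge, and every edge carries exactly one pebble. Initially $H$ has no edges and each vertex carries one pebble of each color. Moves: (add-edge) Let $v,w$ be vertices, not necessarily distinct, whose set $\{v,w\}$ carries at least $\ell+1$ pebbles in total, with $v$ carrying at least one pebble. Pick up a pebble from $v$, add the directed edge $vw$, and put that pebble on it. (pebble-slide) Let $w$ carry a pebble $p$ and let $vw$ be an edge. Replace $vw$ by $wv$, put the pebble from $vw$ onto $v$, and put $p$ on $wv$. A construction is a finite sequence of moves from the initial configuration. -}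

module Defs where

open import Data.Nat using (ℕ; zero; suc; _+_; _*_; _∸_; _≤_)
open import Data.Fin using (Fin)
open import Data.Fin.Properties using (_≟_)
open import Data.Fin.Subset using (Subset; _∈_; ∣_∣)
open import Data.Product using (_×_; _,_)
open import Data.Nat.ListAction using (sum)
open import Data.List using (List; []; _∷_; _++_; map; allFin; concatMap; replicate; length)
open import Data.List.Relation.Unary.All using (All)
open import Data.List.Relation.Binary.Sublist.Propositional using (_⊆_)
open import Relation.Nullary using (yes; no; ¬_)
open import Relation.Binary.PropositionalEquality using (_≡_; _≢_)
open import Relation.Binary.Construct.Closure.ReflexiveTransitive using (Star)

module PebbleGame (k ℓ n : ℕ) where

  Vertex : Set
  Vertex = Fin n

  Color : Set
  Color = Fin k

  DEdge : Set
  DEdge = Vertex × Vertex × Color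

  -- A state: the directed multigraph H (as a list of edges, each with the
  -- color of the pebble it carries) and, for every vertex v and color c,
  -- the number of pebbles of color c lying on v.
  record State : Set where
    constructor ⟨_,_⟩
    field
      edges   : List DEdge
      pebbles : Vertex → Color → ℕ
  open State public

  pebblesAt : (Vertex → Color → ℕ) → Vertex → ℕ
  pebblesAt f v = sum (map (f v) (allFin k))

  pebblesOn : (Vertex → Color → ℕ) → Vertex → Vertex → ℕ
  pebblesOn f v w with v ≟ w
  ... | yes _ = pebblesAt f v
  ... | no  _ = pebblesAt f v + pebblesAt f w

  takePebble : Vertex → Color → (Vertex → Color → ℕ) → (Vertex → Color → ℕ)
  takePebble v c f u d with u ≟ v | d ≟ c
  ... | yes _ | yes _ = f u d ∸ 1
  ... | _     | _     = f u d

  putPebble : Vertex → Color → (Vertex → Color → ℕ) → (Vertex → Color → ℕ)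
  putPebble v c f u d with u ≟ v | d ≟ c
  ... | yes _ | yes _ = suc (f u d)
  ... | _     | _     = f u d

  initial : State
  initial = ⟨ [] , (λ _ _ → 1) ⟩

  data Move : State → State → Set where
    add-edge : ∀ {E f} (v w : Vertex) (c : Color) →
               1 ≤ f v c →
               suc ℓ ≤ pebblesOn f v w →
               Move ⟨ E , f ⟩ ⟨ (v , w , c) ∷ E , takePebble v c f ⟩
    pebble-slide : ∀ {E₁ E₂ f} (v w : Vertex) (c c' : Color) →
               1 ≤ f w c' →
               Move ⟨ E₁ ++ (v , w , c) ∷ E₂ , f ⟩
                    ⟨ E₁ ++ (w , v , c') ∷ E₂ , putPebble v c (takePebble w c' f) ⟩

  Constructible : State → Set
  Constructible = Star Move initial

  -- undirected (multi)edges; a loop is a pair (v , v)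
  UEdge : Set
  UEdge = Vertex × Vertex

  gStar : State → List UEdge
  gStar s = map (λ { (v , w , _) → (v , w) }) (edges s)
            ++ concatMap (λ v → concatMap (λ c → replicate (pebbles s v c) (v , v)) (allFin k)) (allFin n)

  SpannedBy : Subset n → List UEdge → Set
  SpannedBy S F = All (λ { (v , w) → v ∈ S × w ∈ S }) F

  LoopFree : List UEdge → Set
  LoopFree F = All (λ { (v , w) → v ≢ w }) F

  Graded203Tight : List UEdge → Set
  Graded203Tight G =
      (∀ (S : Subset n) (F : List UEdge) → F ⊆ G → SpannedBy S F → LoopFree F →
         1 ≤ length F → length F + 3 ≤ 2 * ∣ S ∣)
    × (∀ (S : Subset n) (F : List UEdge) → F ⊆ G → SpannedBy S F →
         length F ≤ 2 * ∣ S ∣)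
    × (length G ≡ 2 * n)

-- Two invariants of the (k,ℓ)-pebble game give the theorem.  (i) Every vertex u has
-- outdegree(u) + pebbles(u) = k: add-edge turns a pebble of v into an edge leaving v, and
-- pebble-slide trades one unit of outdegree against one pebble between the ends of an edge.
-- (ii) Every vertex set S spanning an edge of H spans at most k|S| − ℓ edges: an edge added
-- inside S needs ℓ + 1 pebbles on S, while (i) summed over S bounds spanned edges plus
-- pebbles on S by k|S|.  The loops of G* at v stand for the pebbles on v, so (i) yields
-- |G*| = kn and the bound k|S| for all subgraphs, and (ii) the bound for loop-free ones.
module Submission where

open import Defs
open import Data.Bool using (true; false; if_then_else_)
open import Data.Empty using (⊥-elim)
open import Data.Fin using (Fin; zero; suc; punchIn; punchOut)
open import Data.Fin.Properties using (_≟_; punchInᵢ≢i; punchIn-punchOut)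
open import Data.Fin.Subset using (Subset; _∈_; _∉_; ∣_∣)
open import Data.Fin.Subset.Properties using (_∈?_)
open import Data.List using (List; []; _∷_; _++_; map; allFin; concatMap; replicate; length; tabulate)
open import Data.List.Properties using (map-++; map-∘; map-cong; map-tabulate; length-tabulate)
open import Data.List.Relation.Binary.Sublist.Propositional using (_⊆_; []; _∷_; _∷ʳ_)
open import Data.List.Relation.Unary.All as All using (All; []; _∷_)
open import Data.Nat using (ℕ; zero; suc; _+_; _*_; _∸_; _≤_; z≤n; s≤s)
open import Data.Nat.Properties hiding (_≟_)
open import Data.Nat.ListAction as List using ()
open import Data.Nat.ListAction.Properties using (sum-++)
open import Data.Nat.Tactic.RingSolver using (solve-∀)
open import Data.Product using (_,_)
open import Data.Vec using ([]; _∷_; lookup)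
open import Data.Vec.Functional using (Vector)
open import Data.Vec.Properties using ([]=⇒lookup; lookup⇒[]=)
open import Function using (_∘_; id)
open import Relation.Binary.Construct.Closure.ReflexiveTransitive using (fold)
open import Relation.Binary.PropositionalEquality
open import Relation.Nullary using (yes; no)

open import Algebra.Properties.Semiring.Sum +-*-semiring
  using (sum; sum-remove; sum-cong-≗; *-distribʳ-sum; sum-replicate-zero)

sum-changeAt : ∀ {n} (g g′ : Vector ℕ n) (i : Fin n) {a b : ℕ} →
               (∀ j → j ≢ i → g j ≡ g′ j) → g′ i + a ≡ g i + b → sum g′ + a ≡ sum g + b
sum-changeAt {suc n} g g′ i {a} {b} agree change = begin
  sum g′ + a                          ≡⟨ cong (_+ a) (sum-remove g′) ⟩
  g′ i + sum (g′ ∘ punchIn i) + a     ≡⟨ cong (λ r → g′ i + r + a) rest ⟩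
  g′ i + r + a                        ≡⟨ shift (g′ i) r a ⟩
  g′ i + a + r                        ≡⟨ cong (_+ r) change ⟩
  g i + b + r                         ≡⟨ shift (g i) b r ⟩
  g i + r + b                         ≡⟨ cong (_+ b) (sum-remove g) ⟨
  sum g + b                           ∎
  where
  open ≡-Reasoning
  r : ℕ
  r = sum (g ∘ punchIn i)
  rest : sum (g′ ∘ punchIn i) ≡ r
  rest = sum-cong-≗ (λ j → sym (agree (punchIn i j) (punchInᵢ≢i i j)))
  shift : ∀ x y z → x + y + z ≡ x + z + y
  shift = solve-∀

sum-≥-component : ∀ {n} (g : Vector ℕ n) (i : Fin n) → g i ≤ sum g
sum-≥-component {suc n} g i = subst (g i ≤_) (sym (sum-remove g)) (m≤m+n (g i) _)

sum-≥-two-components : ∀ {n} (g : Vector ℕ n) {i j : Fin n} → i ≢ j → g i + g j ≤ sum g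
sum-≥-two-components {suc n} g {i} {j} i≢j = begin
  g i + g j                                          ≡⟨ cong (λ k → g i + g k) (punchIn-punchOut i≢j) ⟨
  g i + g (punchIn i (punchOut i≢j))                 ≤⟨ +-monoʳ-≤ (g i) (sum-≥-component (g ∘ punchIn i) _) ⟩
  g i + sum (g ∘ punchIn i)                          ≡⟨ sum-remove g ⟨
  sum g                                              ∎
  where open ≤-Reasoning

weight : {A : Set} → (A → ℕ) → List A → ℕ
weight h xs = List.sum (map h xs)

module _ {A : Set} (h : A → ℕ) where

  weight-++ : ∀ xs ys → weight h (xs ++ ys) ≡ weight h xs + weight h ys
  weight-++ xs ys = trans (cong List.sum (map-++ h xs ys)) (sum-++ (map h xs) (map h ys))

  weight-map : {B : Set} (g : B → A) (xs : List B) → weight h (map g xs) ≡ weight (h ∘ g) xs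
  weight-map g xs = cong List.sum (sym (map-∘ xs))

  weight-concatMap : {B : Set} (g : B → List A) (xs : List B) →
                     weight h (concatMap g xs) ≡ weight (weight h ∘ g) xs
  weight-concatMap g []       = refl
  weight-concatMap g (x ∷ xs) = trans (weight-++ (g x) _) (cong (weight h (g x) +_) (weight-concatMap g xs))

  weight-replicate : ∀ m x → weight h (replicate m x) ≡ m * h x
  weight-replicate zero    x = refl
  weight-replicate (suc m) x = cong (h x +_) (weight-replicate m x)

  length-≤-weight : ∀ {F G} → F ⊆ G → All (λ x → 1 ≤ h x) F → length F ≤ weight h G
  length-≤-weight []        []       = z≤n
  length-≤-weight (y ∷ʳ F⊆G) pos     = ≤-trans (length-≤-weight F⊆G pos) (m≤n+m _ (h y))
  length-≤-weight (refl ∷ F⊆G) (p ∷ pos) = +-mono-≤ p (length-≤-weight F⊆G pos)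

weight-mono : {A : Set} {h h′ : A → ℕ} → (∀ x → h x ≤ h′ x) → ∀ xs → weight h xs ≤ weight h′ xs
weight-mono h≤h′ []       = z≤n
weight-mono h≤h′ (x ∷ xs) = +-mono-≤ (h≤h′ x) (weight-mono h≤h′ xs)

weight-cong : {A : Set} {h h′ : A → ℕ} → (∀ x → h x ≡ h′ x) → ∀ xs → weight h xs ≡ weight h′ xs
weight-cong h≗h′ xs = cong List.sum (map-cong h≗h′ xs)

weight-*ʳ : {A : Set} (g : A → ℕ) (a : ℕ) (xs : List A) → weight (λ x → g x * a) xs ≡ weight g xs * a
weight-*ʳ g a []       = refl
weight-*ʳ g a (x ∷ xs) = trans (cong (g x * a +_) (weight-*ʳ g a xs)) (sym (*-distribʳ-+ a (g x) _))

length≡weight-1 : {A : Set} (xs : List A) → length xs ≡ weight (λ _ → 1) xs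
length≡weight-1 []       = refl
length≡weight-1 (x ∷ xs) = cong suc (length≡weight-1 xs)

weight-allFin : ∀ n (g : Vector ℕ n) → weight g (allFin n) ≡ sum g
weight-allFin n g = trans (cong List.sum (map-tabulate id g)) (sum-tabulate n g)
  where
  sum-tabulate : ∀ n (g : Vector ℕ n) → List.sum (tabulate g) ≡ sum g
  sum-tabulate zero    g = refl
  sum-tabulate (suc n) g = cong (g zero +_) (sum-tabulate n (g ∘ suc))

weight-1-allFin : ∀ n → weight (λ _ → 1) (allFin n) ≡ n
weight-1-allFin n = trans (sym (length≡weight-1 (allFin n))) (length-tabulate id)

sum-1 : ∀ n → sum {n} (λ _ → 1) ≡ n
sum-1 n = trans (sym (weight-allFin n _)) (weight-1-allFin n)

χ : ∀ {n} → Subset n → Fin n → ℕ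
χ S v = if lookup S v then 1 else 0

module _ {n} (S : Subset n) where

  χ-∈ : ∀ {v} → v ∈ S → χ S v ≡ 1
  χ-∈ v∈S rewrite []=⇒lookup v∈S = refl

  χ-∉ : ∀ {v} → v ∉ S → χ S v ≡ 0
  χ-∉ {v} v∉S with lookup S v in eq
  ... | true  = ⊥-elim (v∉S (lookup⇒[]= v S eq))
  ... | false = refl

  χ-∈-*ˡ : ∀ {v} → v ∈ S → ∀ {x} → χ S v * x ≡ x
  χ-∈-*ˡ v∈S = trans (cong (_* _) (χ-∈ v∈S)) (*-identityˡ _)

  χ≤1 : ∀ v → χ S v ≤ 1
  χ≤1 v with lookup S v
  ... | true  = s≤s z≤n
  ... | false = z≤n

  χ-idem : ∀ v → χ S v * χ S v ≡ χ S v
  χ-idem v with lookup S v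
  ... | true  = refl
  ... | false = refl

∣S∣≡sum-χ : ∀ {n} (S : Subset n) → ∣ S ∣ ≡ sum (χ S)
∣S∣≡sum-χ []          = refl
∣S∣≡sum-χ (true ∷ S)  = cong suc (∣S∣≡sum-χ S)
∣S∣≡sum-χ (false ∷ S) = ∣S∣≡sum-χ S

module Invariants (k ℓ n : ℕ) where
  open PebbleGame k ℓ n

  Pebbling : Set
  Pebbling = Vertex → Color → ℕ

  module _ (v : Vertex) (c : Color) (f : Pebbling) where

    takePebble-otherVertex : ∀ {u d} → u ≢ v → takePebble v c f u d ≡ f u d
    takePebble-otherVertex {u} {d} u≢v with u ≟ v
    ... | yes u≡v = ⊥-elim (u≢v u≡v)
    ... | no _    = refl

    takePebble-otherColor : ∀ {u d} → d ≢ c → takePebble v c f u d ≡ f u d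
    takePebble-otherColor {u} {d} d≢c with u ≟ v | d ≟ c
    ... | yes _ | yes d≡c = ⊥-elim (d≢c d≡c)
    ... | yes _ | no _    = refl
    ... | no _  | _       = refl

    takePebble-here : takePebble v c f v c ≡ f v c ∸ 1
    takePebble-here with v ≟ v | c ≟ c
    ... | yes _ | yes _   = refl
    ... | yes _ | no c≢c  = ⊥-elim (c≢c refl)
    ... | no v≢v | _      = ⊥-elim (v≢v refl)

    putPebble-otherVertex : ∀ {u d} → u ≢ v → putPebble v c f u d ≡ f u d
    putPebble-otherVertex {u} {d} u≢v with u ≟ v
    ... | yes u≡v = ⊥-elim (u≢v u≡v)
    ... | no _    = refl

    putPebble-otherColor : ∀ {u d} → d ≢ c → putPebble v c f u d ≡ f u d
    putPebble-otherColor {u} {d} d≢c with u ≟ v | d ≟ c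
    ... | yes _ | yes d≡c = ⊥-elim (d≢c d≡c)
    ... | yes _ | no _    = refl
    ... | no _  | _       = refl

    putPebble-here : putPebble v c f v c ≡ suc (f v c)
    putPebble-here with v ≟ v | c ≟ c
    ... | yes _ | yes _   = refl
    ... | yes _ | no c≢c  = ⊥-elim (c≢c refl)
    ... | no v≢v | _      = ⊥-elim (v≢v refl)

  pebbleWeight : (Vertex → ℕ) → Pebbling → ℕ
  pebbleWeight ω f = sum (λ u → ω u * pebblesAt f u)

  module _ (f f′ : Pebbling) (v : Vertex) {a b : ℕ} where

    pebblesAt-changeAt : (c : Color) → (∀ d → d ≢ c → f v d ≡ f′ v d) → f′ v c + a ≡ f v c + b →
                         pebblesAt f′ v + a ≡ pebblesAt f v + b
    pebblesAt-changeAt c agree change rewrite weight-allFin k (f v) | weight-allFin k (f′ v) =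
      sum-changeAt (f v) (f′ v) c agree change

    pebbleWeight-changeAt : ∀ ω → (∀ u → u ≢ v → pebblesAt f u ≡ pebblesAt f′ u) →
                            pebblesAt f′ v + a ≡ pebblesAt f v + b →
                            pebbleWeight ω f′ + ω v * a ≡ pebbleWeight ω f + ω v * b
    pebbleWeight-changeAt ω agree change = sum-changeAt _ _ v (λ u u≢v → cong (ω u *_) (agree u u≢v)) (begin
      ω v * pebblesAt f′ v + ω v * a   ≡⟨ *-distribˡ-+ (ω v) _ a ⟨
      ω v * (pebblesAt f′ v + a)       ≡⟨ cong (ω v *_) change ⟩
      ω v * (pebblesAt f v + b)        ≡⟨ *-distribˡ-+ (ω v) _ b ⟩
      ω v * pebblesAt f v + ω v * b    ∎)
      where open ≡-Reasoning

  pebbleWeight-takePebble : ∀ ω f v c → 1 ≤ f v c → pebbleWeight ω (takePebble v c f) + ω v ≡ pebbleWeight ω f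
  pebbleWeight-takePebble ω f v c 1≤fvc = begin
    pebbleWeight ω (takePebble v c f) + ω v        ≡⟨ cong (pebbleWeight ω (takePebble v c f) +_) (*-identityʳ (ω v)) ⟨
    pebbleWeight ω (takePebble v c f) + ω v * 1    ≡⟨ pebbleWeight-changeAt f (takePebble v c f) v ω agree atV ⟩
    pebbleWeight ω f + ω v * 0                     ≡⟨ cong (pebbleWeight ω f +_) (*-zeroʳ (ω v)) ⟩
    pebbleWeight ω f + 0                           ≡⟨ +-identityʳ _ ⟩
    pebbleWeight ω f                               ∎
    where
    open ≡-Reasoning
    agree : ∀ u → u ≢ v → pebblesAt f u ≡ pebblesAt (takePebble v c f) u
    agree u u≢v = weight-cong (λ d → sym (takePebble-otherVertex v c f u≢v)) (allFin k)
    atV : pebblesAt (takePebble v c f) v + 1 ≡ pebblesAt f v + 0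
    atV = pebblesAt-changeAt f (takePebble v c f) v c (λ d d≢c → sym (takePebble-otherColor v c f d≢c))
            (trans (cong (_+ 1) (takePebble-here v c f)) (trans (m∸n+n≡m 1≤fvc) (sym (+-identityʳ _))))

  pebbleWeight-putPebble : ∀ ω f v c → pebbleWeight ω (putPebble v c f) ≡ pebbleWeight ω f + ω v
  pebbleWeight-putPebble ω f v c = begin
    pebbleWeight ω (putPebble v c f)               ≡⟨ +-identityʳ _ ⟨
    pebbleWeight ω (putPebble v c f) + 0           ≡⟨ cong (pebbleWeight ω (putPebble v c f) +_) (*-zeroʳ (ω v)) ⟨
    pebbleWeight ω (putPebble v c f) + ω v * 0     ≡⟨ pebbleWeight-changeAt f (putPebble v c f) v ω agree atV ⟩
    pebbleWeight ω f + ω v * 1                     ≡⟨ cong (pebbleWeight ω f +_) (*-identityʳ (ω v)) ⟩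
    pebbleWeight ω f + ω v                         ∎
    where
    open ≡-Reasoning
    agree : ∀ u → u ≢ v → pebblesAt f u ≡ pebblesAt (putPebble v c f) u
    agree u u≢v = weight-cong (λ d → sym (putPebble-otherVertex v c f u≢v)) (allFin k)
    atV : pebblesAt (putPebble v c f) v + 0 ≡ pebblesAt f v + 1
    atV = pebblesAt-changeAt f (putPebble v c f) v c (λ d d≢c → sym (putPebble-otherColor v c f d≢c))
            (trans (cong (_+ 0) (putPebble-here v c f)) (trans (+-identityʳ _) (+-comm 1 _)))

  tailOf : DEdge → Vertex
  tailOf (v , _ , _) = v

  undirect : DEdge → UEdge
  undirect (v , w , _) = v , w

  outWeight : (Vertex → ℕ) → List DEdge → ℕ
  outWeight ω = weight (ω ∘ tailOf)

  inside : Subset n → UEdge → ℕ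
  inside S (v , w) = χ S v * χ S w

  induced : Subset n → List DEdge → ℕ
  induced S = weight (inside S ∘ undirect)

  -- Invariant (i), tested against every weighting ω so that it can be summed over any vertex set.
  Balanced : State → Set
  Balanced s = ∀ ω → outWeight ω (edges s) + pebbleWeight ω (pebbles s) ≡ k * sum ω

  Sparse : State → Set
  Sparse s = ∀ S → 1 ≤ induced S (edges s) → induced S (edges s) + ℓ ≤ k * ∣ S ∣

  induced≤outWeight : ∀ S E → induced S E ≤ outWeight (χ S) E
  induced≤outWeight S = weight-mono (λ { (v , w , _) → ≤-trans (*-monoʳ-≤ (χ S v) (χ≤1 S w)) (≤-reflexive (*-identityʳ _)) })

  induced+pebbles≤k∣S∣ : ∀ s → Balanced s → ∀ S → induced S (edges s) + pebbleWeight (χ S) (pebbles s) ≤ k * ∣ S ∣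
  induced+pebbles≤k∣S∣ s balanced S = begin
    induced S (edges s) + pebbleWeight (χ S) (pebbles s)      ≤⟨ +-monoˡ-≤ _ (induced≤outWeight S (edges s)) ⟩
    outWeight (χ S) (edges s) + pebbleWeight (χ S) (pebbles s) ≡⟨ balanced (χ S) ⟩
    k * sum (χ S)                                              ≡⟨ cong (k *_) (∣S∣≡sum-χ S) ⟨
    k * ∣ S ∣                                                   ∎
    where open ≤-Reasoning

  pebblesOn≤pebbleWeight : ∀ f {S v w} → v ∈ S → w ∈ S → pebblesOn f v w ≤ pebbleWeight (χ S) f
  pebblesOn≤pebbleWeight f {S} {v} {w} v∈S w∈S with v ≟ w
  ... | yes _   = subst (_≤ pebbleWeight (χ S) f) (χ-∈-*ˡ S v∈S) (sum-≥-component _ v)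
  ... | no v≢w  = subst (_≤ pebbleWeight (χ S) f) (cong₂ _+_ (χ-∈-*ˡ S v∈S) (χ-∈-*ˡ S w∈S)) (sum-≥-two-components _ v≢w)

  balanced-step : ∀ {s s′} → Move s s′ → Balanced s → Balanced s′
  balanced-step {⟨ E , f ⟩} (add-edge v w c 1≤fvc _) balanced ω = begin
    ω v + outWeight ω E + pebbleWeight ω (takePebble v c f)    ≡⟨ rotate (ω v) _ _ ⟩
    outWeight ω E + (pebbleWeight ω (takePebble v c f) + ω v)  ≡⟨ cong (outWeight ω E +_) (pebbleWeight-takePebble ω f v c 1≤fvc) ⟩
    outWeight ω E + pebbleWeight ω f                           ≡⟨ balanced ω ⟩
    k * sum ω                                                  ∎
    where
    open ≡-Reasoning
    rotate : ∀ x y z → x + y + z ≡ y + (z + x)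
    rotate = solve-∀
  balanced-step {⟨ _ , f ⟩} (pebble-slide {E₁} {E₂} v w c c′ 1≤fwc′) balanced ω = begin
    outWeight ω (E₁ ++ (w , v , c′) ∷ E₂) + pebbleWeight ω (putPebble v c (takePebble w c′ f))
      ≡⟨ cong₂ _+_ (weight-++ _ E₁ _) (pebbleWeight-putPebble ω (takePebble w c′ f) v c) ⟩
    outWeight ω E₁ + (ω w + outWeight ω E₂) + (pebbleWeight ω (takePebble w c′ f) + ω v)
      ≡⟨ exchange (outWeight ω E₁) (ω w) _ _ (ω v) ⟩
    outWeight ω E₁ + (ω v + outWeight ω E₂) + (pebbleWeight ω (takePebble w c′ f) + ω w)
      ≡⟨ cong₂ _+_ (sym (weight-++ _ E₁ _)) (pebbleWeight-takePebble ω f w c′ 1≤fwc′) ⟩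
    outWeight ω (E₁ ++ (v , w , c) ∷ E₂) + pebbleWeight ω f
      ≡⟨ balanced ω ⟩
    k * sum ω
      ∎
    where
    open ≡-Reasoning
    exchange : ∀ a x b p y → a + (x + b) + (p + y) ≡ a + (y + b) + (p + x)
    exchange = solve-∀

  induced-flip : ∀ S E₁ E₂ v w (c c′ : Color) → induced S (E₁ ++ (w , v , c′) ∷ E₂) ≡ induced S (E₁ ++ (v , w , c) ∷ E₂)
  induced-flip S E₁ E₂ v w c c′ = begin
    induced S (E₁ ++ (w , v , c′) ∷ E₂)                     ≡⟨ weight-++ _ E₁ _ ⟩
    induced S E₁ + (χ S w * χ S v + induced S E₂)            ≡⟨ cong (λ x → induced S E₁ + (x + induced S E₂)) (*-comm (χ S w) _) ⟩
    induced S E₁ + (χ S v * χ S w + induced S E₂)            ≡⟨ weight-++ _ E₁ _ ⟨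
    induced S (E₁ ++ (v , w , c) ∷ E₂)                      ∎
    where open ≡-Reasoning

  sparse-step : ∀ {s s′} → Move s s′ → Balanced s → Sparse s → Sparse s′
  sparse-step {⟨ E , f ⟩} (add-edge v w c _ ℓ<pebblesOn) balanced sparse S 1≤induced with v ∈? S | w ∈? S
  ... | yes v∈S | yes w∈S = begin
    χ S v * χ S w + induced S E + ℓ       ≡⟨ cong (λ x → x + induced S E + ℓ) (cong₂ _*_ (χ-∈ S v∈S) (χ-∈ S w∈S)) ⟩
    1 + induced S E + ℓ                   ≡⟨ shift (induced S E) ℓ ⟩
    induced S E + suc ℓ                   ≤⟨ +-monoʳ-≤ _ (≤-trans ℓ<pebblesOn (pebblesOn≤pebbleWeight f v∈S w∈S)) ⟩
    induced S E + pebbleWeight (χ S) f    ≤⟨ induced+pebbles≤k∣S∣ ⟨ E , f ⟩ balanced S ⟩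
    k * ∣ S ∣                              ∎
    where
    open ≤-Reasoning
    shift : ∀ x y → 1 + x + y ≡ x + (1 + y)
    shift = solve-∀
  ... | no v∉S | _ rewrite χ-∉ S v∉S = sparse S 1≤induced
  ... | yes _ | no w∉S rewrite χ-∉ S w∉S | *-zeroʳ (χ S v) = sparse S 1≤induced
  sparse-step (pebble-slide {E₁} {E₂} v w c c′ _) _ sparse S
    rewrite induced-flip S E₁ E₂ v w c c′ = sparse S

  balanced-initial : Balanced initial
  balanced-initial ω = begin
    sum (λ u → ω u * pebblesAt (λ _ _ → 1) u)   ≡⟨ sum-cong-≗ (λ u → cong (ω u *_) (weight-1-allFin k)) ⟩
    sum (λ u → ω u * k)                         ≡⟨ *-distribʳ-sum k ω ⟨
    sum ω * k                                   ≡⟨ *-comm (sum ω) k ⟩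
    k * sum ω                                   ∎
    where open ≡-Reasoning

  record Invariant (s : State) : Set where
    constructor _,_
    field
      balanced : Balanced s
      sparse   : Sparse s

  constructible⇒invariant : ∀ {s} → Constructible s → Invariant s
  constructible⇒invariant c = fold (λ s s′ → Invariant s → Invariant s′) step id c (balanced-initial , λ S ())
    where
    step : ∀ {s s′ s″} → Move s s′ → (Invariant s′ → Invariant s″) → Invariant s → Invariant s″
    step m rest (balanced , sparse) = rest (balanced-step m balanced , sparse-step m balanced sparse)

  weight-gStar : ∀ (h : UEdge → ℕ) s →
                 weight h (gStar s) ≡ weight (h ∘ undirect) (edges s) + sum (λ v → h (v , v) * pebblesAt (pebbles s) v)
  weight-gStar h ⟨ E , f ⟩ = begin
    weight h (gStar ⟨ E , f ⟩)
      ≡⟨ weight-++ h (map _ E) _ ⟩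
    weight h (map _ E) + weight h (concatMap loopsAt (allFin n))
      ≡⟨ cong₂ _+_ (weight-map h _ E) (weight-concatMap h loopsAt (allFin n)) ⟩
    weight (h ∘ undirect) E + weight (weight h ∘ loopsAt) (allFin n)
      ≡⟨ cong (weight (h ∘ undirect) E +_) (trans (weight-cong loops-weight (allFin n)) (weight-allFin n _)) ⟩
    weight (h ∘ undirect) E + sum (λ v → h (v , v) * pebblesAt f v)
      ∎
    where
    open ≡-Reasoning
    loopsAt : Vertex → List UEdge
    loopsAt v = concatMap (λ c → replicate (f v c) (v , v)) (allFin k)
    loops-weight : ∀ v → weight h (loopsAt v) ≡ h (v , v) * pebblesAt f v
    loops-weight v = begin
      weight h (loopsAt v)                            ≡⟨ weight-concatMap h _ (allFin k) ⟩
      weight (λ c → weight h (replicate (f v c) (v , v))) (allFin k)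
                                                      ≡⟨ weight-cong (λ c → weight-replicate h (f v c) (v , v)) (allFin k) ⟩
      weight (λ c → f v c * h (v , v)) (allFin k)     ≡⟨ weight-*ʳ (f v) (h (v , v)) (allFin k) ⟩
      pebblesAt f v * h (v , v)                       ≡⟨ *-comm (pebblesAt f v) _ ⟩
      h (v , v) * pebblesAt f v                       ∎

  gStar-length : ∀ s → Balanced s → length (gStar s) ≡ k * n
  gStar-length s balanced = begin
    length (gStar s)                                                       ≡⟨ length≡weight-1 (gStar s) ⟩
    weight (λ _ → 1) (gStar s)                                             ≡⟨ weight-gStar (λ _ → 1) s ⟩
    outWeight (λ _ → 1) (edges s) + sum (λ v → 1 * pebblesAt (pebbles s) v) ≡⟨ balanced (λ _ → 1) ⟩
    k * sum {n} (λ _ → 1)                                                  ≡⟨ cong (k *_) (sum-1 n) ⟩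
    k * n                                                                  ∎
    where open ≡-Reasoning

  inside-positive : ∀ S {v w} → v ∈ S → w ∈ S → 1 ≤ inside S (v , w)
  inside-positive S v∈S w∈S = ≤-reflexive (sym (cong₂ _*_ (χ-∈ S v∈S) (χ-∈ S w∈S)))

  spanned⇒inside : ∀ {S F} → SpannedBy S F → All (λ e → 1 ≤ inside S e) F
  spanned⇒inside {S} = All.map (λ (v∈S , w∈S) → inside-positive S v∈S w∈S)

  gStar-subgraph-bound : ∀ s → Balanced s → ∀ S F → F ⊆ gStar s → SpannedBy S F → length F ≤ k * ∣ S ∣
  gStar-subgraph-bound s balanced S F F⊆G* spanned = begin
    length F                                                                ≤⟨ length-≤-weight (inside S) F⊆G* (spanned⇒inside spanned) ⟩
    weight (inside S) (gStar s)                                             ≡⟨ weight-gStar (inside S) s ⟩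
    induced S (edges s) + sum (λ v → χ S v * χ S v * pebblesAt (pebbles s) v)
                                                                            ≡⟨ cong (induced S (edges s) +_) (sum-cong-≗ (λ v → cong (_* _) (χ-idem S v))) ⟩
    induced S (edges s) + pebbleWeight (χ S) (pebbles s)                    ≤⟨ induced+pebbles≤k∣S∣ s balanced S ⟩
    k * ∣ S ∣                                                                ∎
    where open ≤-Reasoning

  insideNonLoop : Subset n → UEdge → ℕ
  insideNonLoop S (v , w) with v ≟ w
  ... | yes _ = 0
  ... | no  _ = inside S (v , w)

  insideNonLoop-loop : ∀ S v → insideNonLoop S (v , v) ≡ 0
  insideNonLoop-loop S v with v ≟ v
  ... | yes _  = refl
  ... | no v≢v = ⊥-elim (v≢v refl)

  insideNonLoop-≢ : ∀ S {v w} → v ≢ w → insideNonLoop S (v , w) ≡ inside S (v , w)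
  insideNonLoop-≢ S {v} {w} v≢w with v ≟ w
  ... | yes v≡w = ⊥-elim (v≢w v≡w)
  ... | no  _   = refl

  insideNonLoop≤inside : ∀ S e → insideNonLoop S e ≤ inside S e
  insideNonLoop≤inside S (v , w) with v ≟ w
  ... | yes _ = z≤n
  ... | no  _ = ≤-refl

  spanned⇒insideNonLoop : ∀ {S F} → SpannedBy S F → LoopFree F → All (λ e → 1 ≤ insideNonLoop S e) F
  spanned⇒insideNonLoop {S} spanned loopFree = All.zipWith
    (λ ((v∈S , w∈S) , v≢w) → subst (1 ≤_) (sym (insideNonLoop-≢ S v≢w)) (inside-positive S v∈S w∈S))
    (spanned , loopFree)

  gStar-loopFree-subgraph-bound : ∀ s → Sparse s → ∀ S F → F ⊆ gStar s → SpannedBy S F → LoopFree F →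
                          1 ≤ length F → length F + ℓ ≤ k * ∣ S ∣
  gStar-loopFree-subgraph-bound s sparse S F F⊆G* spanned loopFree 1≤∣F∣ =
    ≤-trans (+-monoˡ-≤ ℓ ∣F∣≤induced) (sparse S (≤-trans 1≤∣F∣ ∣F∣≤induced))
    where
    open ≤-Reasoning
    no-loops : sum (λ v → insideNonLoop S (v , v) * pebblesAt (pebbles s) v) ≡ 0
    no-loops = trans (sum-cong-≗ (λ v → cong (_* _) (insideNonLoop-loop S v))) (sum-replicate-zero n)
    ∣F∣≤induced : length F ≤ induced S (edges s)
    ∣F∣≤induced = begin
      length F                                          ≤⟨ length-≤-weight (insideNonLoop S) F⊆G* (spanned⇒insideNonLoop spanned loopFree) ⟩
      weight (insideNonLoop S) (gStar s)                 ≡⟨ weight-gStar (insideNonLoop S) s ⟩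
      weight (insideNonLoop S ∘ undirect) (edges s) + sum (λ v → insideNonLoop S (v , v) * pebblesAt (pebbles s) v)
                                                        ≡⟨ cong (weight (insideNonLoop S ∘ undirect) (edges s) +_) no-loops ⟩
      weight (insideNonLoop S ∘ undirect) (edges s) + 0  ≡⟨ +-identityʳ _ ⟩
      weight (insideNonLoop S ∘ undirect) (edges s)      ≤⟨ weight-mono (insideNonLoop≤inside S ∘ undirect) (edges s) ⟩
      induced S (edges s)                               ∎

corollary3 : (n : ℕ) (s : PebbleGame.State 2 3 n) → PebbleGame.Constructible 2 3 n s → PebbleGame.Graded203Tight 2 3 n (PebbleGame.gStar 2 3 n s)
corollary3 n s constructible =
    gStar-loopFree-subgraph-bound s sparse
  , gStar-subgraph-bound s balanced
  , gStar-length s balanced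
  where
  open Invariants 2 3 n
  open Invariant (constructible⇒invariant constructible)
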